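{- For every $n$, the restriction of the middle order $\mathcal{P}_n$ to the set of $213$-avoiding permutations of size $n$ coincides with the restriction of the Bruhat order to that set: for $213$-avoiding $v,w\in S_n$, $v\le w$ in $\mathcal{P}_n$ if and only if $v\le w$ in the Bruhat order.
   Context: For $w\in S_n$ (one-line notation), its inversion sequence is $I(w)=(x_1,\ldots,x_n)$ with $x_i=\#\{j<i : w^{ -1}(j)>w^{ -1}(i)\}$. The middle order $\mathcal{P}_n$ on $S_n$: $v\le w$ iff $I(v)\le I(w)$ coordinate-wise. The Bruhat order on $S_n$ is the transitive closure of the relations $v<w$ where $w$ is obtained from $v$ by swapping entries in positions $a<b$ with $v(a)<v(b)$ such that no $c$ with $a<c<b$ has $v(a)<v(c)<v(b)$. A permutation avoids $213$ if it has no indices $i<j<k$ with $w(j)<w(i)<w(k)$. -}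

module Defs where

open import Data.Nat using (ℕ) renaming (_≤_ to _≤ℕ_)
open import Data.Fin using (Fin; _<_; _<?_)
open import Data.Fin.Permutation using (Permutation′; _⟨$⟩ʳ_; _⟨$⟩ˡ_; transpose)
open import Data.List using (length; filter)
open import Data.Product using (Σ; ∃; _×_; _,_)
open import Relation.Nullary using (¬_)
open import Relation.Nullary.Decidable using (_×-dec_)
open import Relation.Binary.PropositionalEquality using (_≡_)
import Data.List.Base as ListB

-- A permutation w ∈ S_n, with one-line notation  i ↦ w ⟨$⟩ʳ i
-- (values and positions indexed by Fin n, i.e. 0-based).
Perm : ℕ → Set
Perm n = Permutation′ n

inv : ∀ {n} → Perm n → Fin n → ℕ
inv {n} w i =
  length (filter (λ j → (j <? i) ×-dec ((w ⟨$⟩ˡ i) <? (w ⟨$⟩ˡ j)))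
                 (ListB.allFin n))

_≤M_ : ∀ {n} → Perm n → Perm n → Set
v ≤M w = ∀ i → inv v i ≤ℕ inv w i

BruhatStep : ∀ {n} → Perm n → Perm n → Set
BruhatStep {n} v w =
  Σ (Fin n) λ a → Σ (Fin n) λ b →
    (a < b) ×
    ((v ⟨$⟩ʳ a) < (v ⟨$⟩ʳ b)) ×
    (∀ c → a < c → c < b → ¬ (((v ⟨$⟩ʳ a) < (v ⟨$⟩ʳ c)) × ((v ⟨$⟩ʳ c) < (v ⟨$⟩ʳ b)))) ×
    (∀ i → w ⟨$⟩ʳ i ≡ v ⟨$⟩ʳ (transpose a b ⟨$⟩ʳ i))

data _≤B_ {n : ℕ} : Perm n → Perm n → Set where
  ≤B-refl : ∀ {v w} → (∀ i → v ⟨$⟩ʳ i ≡ w ⟨$⟩ʳ i) → v ≤B w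
  ≤B-step : ∀ {u v w} → BruhatStep u v → v ≤B w → u ≤B w

Avoids213 : ∀ {n} → Perm n → Set
Avoids213 {n} w =
  ∀ (i j k : Fin n) → i < j → j < k →
    ¬ (((w ⟨$⟩ʳ j) < (w ⟨$⟩ʳ i)) × ((w ⟨$⟩ʳ i) < (w ⟨$⟩ʳ k)))

module Submission where

-- Middle ⇒ Bruhat holds for all permutations. If x_i(v) < x_i(w) then x_i(v) < i, so some value below i
-- stands before i in v; swapping i with the last such value j is a Bruhat step that raises x_i by one and
-- leaves every other x_k unchanged. Repeating this decreases Σ_k (x_k(w) ∸ x_k(v)) until the inversion
-- sequences agree, and a permutation is determined by its inversion sequence, because x_i fixes where i
-- is inserted among the smaller values.
-- Bruhat ⇒ middle for 213-avoiding v: the x_i(v) values below i that follow i fill the last x_i(v)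
-- positions, since a value above i among them would complete a 213 pattern with i. "The last m positions
-- hold values below i" survives every Bruhat step, which moves a smaller value to the right, and it
-- forces x_i ≥ m.

open import Defs
open import Data.Bool using (true; false; if_then_else_)
open import Data.Nat as ℕ using (ℕ; zero; suc; _+_; _∸_; z≤n; s≤s; s≤s⁻¹; z<s; s<s; s<s⁻¹)
  renaming (_≤_ to _≤ℕ_; _<_ to _<ℕ_)
open import Data.Nat.Properties
  using ( +-0-commutativeMonoid; ≤-reflexive; ≤-antisym; ≤-trans; <⇒≤; <-≤-trans; ≮⇒≥; ≰⇒>; <⇒≱; <⇒≢
        ; n≮0; n<1+n; m<1+n⇒m<n∨m≡n; suc-injective; +-mono-≤; +-suc; 0∸n≡0; +-∸-assoc; m∸[m∸n]≡n
        ; m∸n≢0⇒n<m; ∸-monoʳ-≤; module ≤-Reasoning)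
open import Data.Fin using (Fin; zero; suc; toℕ; _≤_; _<_; _<?_; _≟_)
import Data.Fin.Properties as Fin
open import Data.Fin.Permutation using (Permutation′; _⟨$⟩ʳ_; _⟨$⟩ˡ_; _∘ₚ_; transpose; inverseˡ; inverseʳ)
import Data.Fin.Permutation.Components as PC
open import Data.List using (length; filter; tabulate)
open import Data.Product using (Σ; ∃; _×_; _,_; proj₁; uncurry)
open import Data.Sum using (_⊎_; inj₁; inj₂)
open import Function using (_∘_; id)
open import Relation.Binary using (tri<; tri≈; tri>)
open import Relation.Binary.PropositionalEquality
open import Relation.Nullary using (¬_; Dec; yes; no; does; contradiction)
open import Relation.Nullary.Decidable using (_×-dec_; _⊎-dec_)
open import Relation.Unary using (Pred; Decidable; _⊆_)

open import Algebra.Properties.CommutativeMonoid.Sum +-0-commutativeMonoid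
  using (sum; sum-cong-≗; sum-permute)

𝟙 : ∀ {a} {A : Set a} → Dec A → ℕ
𝟙 d = if does d then 1 else 0

𝟙-yes : ∀ {a} {A : Set a} → A → (d : Dec A) → 𝟙 d ≡ 1
𝟙-yes _ (yes _) = refl
𝟙-yes a (no ¬a) = contradiction a ¬a

𝟙-no : ∀ {a} {A : Set a} → ¬ A → (d : Dec A) → 𝟙 d ≡ 0
𝟙-no ¬a (yes a) = contradiction a ¬a
𝟙-no _  (no _)  = refl

𝟙-mono : ∀ {a b} {A : Set a} {B : Set b} → (A → B) → (d : Dec A) (e : Dec B) → 𝟙 d ≤ℕ 𝟙 e
𝟙-mono f (yes a) e = ≤-reflexive (sym (𝟙-yes (f a) e))
𝟙-mono f (no _)  e = z≤n

𝟙-cong : ∀ {a b} {A : Set a} {B : Set b} → (A → B) → (B → A) → (d : Dec A) (e : Dec B) → 𝟙 d ≡ 𝟙 e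
𝟙-cong f g d e = ≤-antisym (𝟙-mono f d e) (𝟙-mono g e d)

sum-mono-≤ : ∀ {n} {f g : Fin n → ℕ} → (∀ x → f x ≤ℕ g x) → sum f ≤ℕ sum g
sum-mono-≤ {zero}  _   = z≤n
sum-mono-≤ {suc n} f≤g = +-mono-≤ (f≤g zero) (sum-mono-≤ (f≤g ∘ suc))

sum-suc-at : ∀ {n} {f g : Fin n → ℕ} (j : Fin n) → f j ≡ suc (g j) →
             (∀ k → k ≢ j → f k ≡ g k) → sum f ≡ suc (sum g)
sum-suc-at zero fj f≗g = cong₂ _+_ fj (sum-cong-≗ (λ k → f≗g (suc k) λ ()))
sum-suc-at {g = g} (suc j) fj f≗g = trans
  (cong₂ _+_ (f≗g zero λ ()) (sum-suc-at j fj (λ k k≢j → f≗g (suc k) (k≢j ∘ Fin.suc-injective))))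
  (+-suc (g zero) _)

count : ∀ {n p} {P : Pred (Fin n) p} → Decidable P → ℕ
count P? = sum (λ x → 𝟙 (P? x))

module _ {n p q} {P : Pred (Fin n) p} {Q : Pred (Fin n) q} where

  count-mono : (P? : Decidable P) (Q? : Decidable Q) → P ⊆ Q → count P? ≤ℕ count Q?
  count-mono P? Q? P⊆Q = sum-mono-≤ (λ x → 𝟙-mono P⊆Q (P? x) (Q? x))

  count-cong : (P? : Decidable P) (Q? : Decidable Q) → P ⊆ Q → Q ⊆ P → count P? ≡ count Q?
  count-cong P? Q? P⊆Q Q⊆P = sum-cong-≗ (λ x → 𝟙-cong P⊆Q Q⊆P (P? x) (Q? x))

module _ {n p} {P : Pred (Fin n) p} (P? : Decidable P) where

  count-permute : (π : Permutation′ n) → count P? ≡ count (P? ∘ (π ⟨$⟩ʳ_))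
  count-permute π = sum-permute (λ x → 𝟙 (P? x)) π

  count-insert : ∀ {j} → ¬ P j → count (λ x → P? x ⊎-dec x ≟ j) ≡ suc (count P?)
  count-insert {j} ¬Pj = sum-suc-at j
    (trans (𝟙-yes (inj₂ refl) (P? j ⊎-dec j ≟ j)) (cong suc (sym (𝟙-no ¬Pj (P? j)))))
    (λ k k≢j → 𝟙-cong (λ { (inj₁ Pk) → Pk ; (inj₂ k≡j) → contradiction k≡j k≢j }) inj₁
                      (P? k ⊎-dec k ≟ j) (P? k))


count-none : ∀ {n p} {P : Pred (Fin n) p} (P? : Decidable P) → (∀ x → ¬ P x) → count P? ≡ 0
count-none {zero}  P? ¬P = refl
count-none {suc n} P? ¬P = cong₂ _+_ (𝟙-no (¬P zero) (P? zero)) (count-none (P? ∘ suc) (¬P ∘ suc))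

count-all : ∀ {n p} {P : Pred (Fin n) p} (P? : Decidable P) → (∀ x → P x) → count P? ≡ n
count-all {zero}  P? P = refl
count-all {suc n} P? P = cong₂ _+_ (𝟙-yes (P zero) (P? zero)) (count-all (P? ∘ suc) (P ∘ suc))

length-filter-tabulate : ∀ {n a p} {A : Set a} {P : Pred A p} (P? : Decidable P) (f : Fin n → A) →
                         length (filter P? (tabulate f)) ≡ count (P? ∘ f)
length-filter-tabulate {zero}  P? f = refl
length-filter-tabulate {suc n} P? f with does (P? (f zero))
... | true  = cong suc (length-filter-tabulate P? (f ∘ suc))
... | false = length-filter-tabulate P? (f ∘ suc)

count-< : ∀ {n} (p : Fin n) → count {n} (_<? p) ≡ toℕ p
count-< {suc n} zero = count-none {suc n} (_<? zero {n}) (λ _ ())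
count-< {suc n} (suc p) = cong₂ _+_ (𝟙-yes z<s (zero {n} <? suc p))
  (trans (count-cong {n} (λ x → suc x <? suc p) (_<? p) s<s⁻¹ s<s) (count-< p))

count-≥ : ∀ n t → count {n} (λ q → t ℕ.≤? toℕ q) ≡ n ∸ t
count-≥ zero    t       = sym (0∸n≡0 t)
count-≥ (suc n) zero    = count-all (λ q → zero ℕ.≤? toℕ q) (λ _ → z≤n)
count-≥ (suc n) (suc t) = cong₂ _+_ (𝟙-no (λ ()) (suc t ℕ.≤? zero))
  (trans (count-cong {n} (λ q → suc t ℕ.≤? suc (toℕ q)) (λ q → t ℕ.≤? toℕ q) s≤s⁻¹ s≤s) (count-≥ n t))

pos : ∀ {n} → Perm n → Fin n → Fin n
pos w x = w ⟨$⟩ˡ x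

pos-injective : ∀ {n} (w : Perm n) {x y} → pos w x ≡ pos w y → x ≡ y
pos-injective w eq = trans (sym (inverseʳ w)) (trans (cong (w ⟨$⟩ʳ_) eq) (inverseʳ w))

Inversion : ∀ {n} → Perm n → Fin n → Fin n → Set
Inversion w i x = x < i × pos w i < pos w x

inversion? : ∀ {n} (w : Perm n) (i : Fin n) → Decidable (Inversion w i)
inversion? w i x = (x <? i) ×-dec (pos w i <? pos w x)

inv≡count : ∀ {n} (w : Perm n) (i : Fin n) → inv w i ≡ count (inversion? w i)
inv≡count w i = length-filter-tabulate (inversion? w i) id

inv-cong : ∀ {n} {v w : Perm n} {i k : Fin n} →
           Inversion v i ⊆ Inversion w k → Inversion w k ⊆ Inversion v i → inv v i ≡ inv w k
inv-cong {v = v} {w} {i} {k} v⊆w w⊆v = begin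
  inv v i                 ≡⟨ inv≡count v i ⟩
  count (inversion? v i)  ≡⟨ count-cong (inversion? v i) (inversion? w k) v⊆w w⊆v ⟩
  count (inversion? w k)  ≡⟨ inv≡count w k ⟨
  inv w k                 ∎
  where open ≡-Reasoning

InversionAt : ∀ {n} → Perm n → Fin n → Fin n → Set
InversionAt w i p = w ⟨$⟩ʳ p < i × pos w i < p

inversionAt? : ∀ {n} (w : Perm n) (i : Fin n) → Decidable (InversionAt w i)
inversionAt? w i p = (w ⟨$⟩ʳ p <? i) ×-dec (pos w i <? p)

inv≡count-positions : ∀ {n} (w : Perm n) (i : Fin n) → inv w i ≡ count (inversionAt? w i)
inv≡count-positions w i = begin
  inv w i                                 ≡⟨ inv≡count w i ⟩
  count (inversion? w i)                  ≡⟨ count-permute (inversion? w i) w ⟩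
  count (inversion? w i ∘ (w ⟨$⟩ʳ_))      ≡⟨ count-cong (inversion? w i ∘ (w ⟨$⟩ʳ_)) (inversionAt? w i)
                                               (λ (wp<i , lt) → wp<i , subst (_ <_) (inverseˡ w) lt)
                                               (λ (wp<i , lt) → wp<i , subst (_ <_) (sym (inverseˡ w)) lt) ⟩
  count (inversionAt? w i)                ∎
  where open ≡-Reasoning

inv≤ : ∀ {n} (w : Perm n) (i : Fin n) → inv w i ≤ℕ toℕ i
inv≤ {n} w i = begin
  inv w i                  ≡⟨ inv≡count w i ⟩
  count (inversion? w i)   ≤⟨ count-mono (inversion? w i) (_<? i) proj₁ ⟩
  count {n} (_<? i)        ≡⟨ count-< i ⟩
  toℕ i                    ∎
  where open ≤-Reasoning

module _ {n} (a b : Fin n) where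

  transpose-matchˡ : PC.transpose a b a ≡ b
  transpose-matchˡ with a ≟ a
  ... | yes _   = refl
  ... | no a≢a = contradiction refl a≢a

  transpose-matchʳ : PC.transpose a b b ≡ a
  transpose-matchʳ with b ≟ a
  ... | yes b≡a = b≡a
  ... | no _ with b ≟ b
  ...   | yes _   = refl
  ...   | no b≢b = contradiction refl b≢b

  transpose-fixes : ∀ {p} → p ≢ a → p ≢ b → PC.transpose a b p ≡ p
  transpose-fixes {p} p≢a p≢b with p ≟ a
  ... | yes p≡a = contradiction p≡a p≢a
  ... | no _ with p ≟ b
  ...   | yes p≡b = contradiction p≡b p≢b
  ...   | no _    = refl

transpose-preserves : ∀ {n ℓ} (P : Pred (Fin n) ℓ) {a b : Fin n} → (P a → P b) → (P b → P a) →
                      ∀ {p} → P p → P (PC.transpose a b p)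
transpose-preserves P {a} {b} Pa⇒Pb Pb⇒Pa {p} Pp = by-cases (p ≟ a) (p ≟ b)
  where
  τ = PC.transpose a b
  by-cases : Dec (p ≡ a) → Dec (p ≡ b) → P (τ p)
  by-cases (yes p≡a) _       = subst P (sym (trans (cong τ p≡a) (transpose-matchˡ a b)))
                                       (Pa⇒Pb (subst P p≡a Pp))
  by-cases (no _) (yes p≡b)  = subst P (sym (trans (cong τ p≡b) (transpose-matchʳ a b)))
                                       (Pb⇒Pa (subst P p≡b Pp))
  by-cases (no p≢a) (no p≢b) = subst P (sym (transpose-fixes a b p≢a p≢b)) Pp

transpose-reflects : ∀ {n ℓ} (P : Pred (Fin n) ℓ) {a b : Fin n} → (P a → P b) → (P b → P a) →
                     ∀ {p} → P (PC.transpose a b p) → P p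
transpose-reflects P Pa⇒Pb Pb⇒Pa Pτp =
  subst P (PC.transpose-inverse _ _) (transpose-preserves P Pb⇒Pa Pa⇒Pb Pτp)

module RaisingTransposition {n} (v : Perm n) (i a : Fin n) (a<b : a < pos v i) (va<i : v ⟨$⟩ʳ a < i)
         (gap : ∀ q → a < q → q < pos v i → i < v ⟨$⟩ʳ q) where

  private
    b = pos v i
    j = v ⟨$⟩ʳ a

  raised : Perm n
  raised = transpose a b ∘ₚ v

  private
    v′ = raised

    pos-j : pos v j ≡ a
    pos-j = inverseˡ v

    pos′-i : pos v′ i ≡ a
    pos′-i = transpose-matchˡ b a

    pos′-j : pos v′ j ≡ b
    pos′-j = trans (cong (PC.transpose b a) pos-j) (transpose-matchʳ b a)

    pos′-other : ∀ {x} → x ≢ i → x ≢ j → pos v′ x ≡ pos v x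
    pos′-other x≢i x≢j =
      transpose-fixes b a (x≢i ∘ pos-injective v) (λ px≡a → x≢j (pos-injective v (trans px≡a (sym pos-j))))

    below-i⇒outside-gap : ∀ {x} → x < i → pos v x < b → pos v x ≤ a
    below-i⇒outside-gap {x} x<i px<b = ≮⇒≥ λ a<px →
      Fin.<-asym x<i (subst (i <_) (inverseʳ v) (gap (pos v x) a<px px<b))

  step : BruhatStep v raised
  step = a , b , a<b , subst (j <_) (sym (inverseʳ v)) va<i
       , (λ c a<c c<b (_ , vc<vb) → Fin.<-asym (gap c a<c c<b) (subst (v ⟨$⟩ʳ c <_) (inverseʳ v) vc<vb))
       , (λ _ → refl)

  private
    beyond-gap : ∀ {x} → x < i → a < pos v x → b < pos v x
    beyond-gap {x} x<i a<px with Fin.<-cmp b (pos v x)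
    ... | tri< b<px _ _ = b<px
    ... | tri≈ _ b≡px _ = contradiction (pos-injective v (sym b≡px)) (Fin.<⇒≢ x<i)
    ... | tri> _ _ px<b = contradiction (below-i⇒outside-gap x<i px<b) (<⇒≱ a<px)

    pos′-transpose : ∀ x → pos v′ (PC.transpose i j x) ≡ pos v x
    pos′-transpose x = by-cases (x ≟ i) (x ≟ j)
      where
      τ = PC.transpose i j
      by-cases : Dec (x ≡ i) → Dec (x ≡ j) → pos v′ (τ x) ≡ pos v x
      by-cases (yes refl) _ = trans (cong (pos v′) (transpose-matchˡ i j)) pos′-j
      by-cases (no _) (yes refl) = trans (cong (pos v′) (transpose-matchʳ i j)) (trans pos′-i (sym pos-j))
      by-cases (no x≢i) (no x≢j) = trans (cong (pos v′) (transpose-fixes i j x≢i x≢j)) (pos′-other x≢i x≢j)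

  inv-raised : inv raised i ≡ suc (inv v i)
  inv-raised = begin
    inv v′ i                                    ≡⟨ inv≡count v′ i ⟩
    count (inversion? v′ i)                     ≡⟨ count-cong (inversion? v′ i)
                                                     (λ x → inversion? v i x ⊎-dec x ≟ j) gained regained ⟩
    count (λ x → inversion? v i x ⊎-dec x ≟ j)  ≡⟨ count-insert (inversion? v i) j-not-inverted ⟩
    suc (count (inversion? v i))                ≡⟨ cong suc (inv≡count v i) ⟨
    suc (inv v i)                               ∎
    where
    open ≡-Reasoning
    j-not-inverted : ¬ Inversion v i j
    j-not-inverted (_ , b<pj) = Fin.<-asym a<b (subst (b <_) pos-j b<pj)
    gained : Inversion v′ i ⊆ λ x → Inversion v i x ⊎ x ≡ j
    gained {x} (x<i , p′i<p′x) with x ≟ j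
    ... | yes x≡j = inj₂ x≡j
    ... | no x≢j  = inj₁ (x<i , beyond-gap x<i (subst₂ _<_ pos′-i (pos′-other (Fin.<⇒≢ x<i) x≢j) p′i<p′x))
    regained : (λ x → Inversion v i x ⊎ x ≡ j) ⊆ Inversion v′ i
    regained {x} (inj₁ (x<i , b<px)) = x<i , subst₂ _<_ (sym pos′-i) (sym (pos′-other (Fin.<⇒≢ x<i) x≢j))
                                                       (Fin.<-trans a<b b<px)
      where x≢j : x ≢ j
            x≢j refl = j-not-inverted (x<i , b<px)
    regained (inj₂ refl) = va<i , subst₂ _<_ (sym pos′-i) (sym pos′-j) a<b

  private
    inv-kept-at-j : inv raised j ≡ inv v j
    inv-kept-at-j = inv-cong {v = v′} {v} lower raise
      where
      x≢i,j : ∀ {x} → x < j → x ≢ i × x ≢ j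
      x≢i,j x<j = Fin.<⇒≢ (Fin.<-trans x<j va<i) , Fin.<⇒≢ x<j
      lower : Inversion v′ j ⊆ Inversion v j
      lower {x} (x<j , p′j<p′x) = x<j , subst₂ _<_ (sym pos-j) (uncurry pos′-other (x≢i,j x<j))
                                                  (Fin.<-trans a<b (subst (_< pos v′ x) pos′-j p′j<p′x))
      raise : Inversion v j ⊆ Inversion v′ j
      raise {x} (x<j , pj<px) = x<j , subst₂ _<_ (sym pos′-j) (sym (uncurry pos′-other (x≢i,j x<j)))
                                        (beyond-gap (Fin.<-trans x<j va<i) (subst (_< pos v x) pos-j pj<px))

    -- Above i, exchanging the values i and j matches the inversions of k in raised with those in v.
    inv-kept-above : ∀ {k} → i < k → inv raised k ≡ inv v k
    inv-kept-above {k} i<k = begin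
      inv v′ k                                         ≡⟨ inv≡count v′ k ⟩
      count (inversion? v′ k)                          ≡⟨ count-permute (inversion? v′ k) (transpose i j) ⟩
      count (inversion? v′ k ∘ PC.transpose i j)       ≡⟨ count-cong (inversion? v′ k ∘ PC.transpose i j)
                                                                     (inversion? v k) unswap swap ⟩
      count (inversion? v k)                           ≡⟨ inv≡count v k ⟨
      inv v k                                          ∎
      where
      open ≡-Reasoning
      j<k = Fin.<-trans va<i i<k
      pos′-k : pos v′ k ≡ pos v k
      pos′-k = pos′-other (Fin.<⇒≢ i<k ∘ sym) (Fin.<⇒≢ j<k ∘ sym)
      unswap : (Inversion v′ k ∘ PC.transpose i j) ⊆ Inversion v k
      unswap {x} (τx<k , lt) = transpose-reflects (_< k) (λ _ → j<k) (λ _ → i<k) τx<k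
                             , subst₂ _<_ pos′-k (pos′-transpose x) lt
      swap : Inversion v k ⊆ (Inversion v′ k ∘ PC.transpose i j)
      swap {x} (x<k , lt) = transpose-preserves (_< k) (λ _ → j<k) (λ _ → i<k) x<k
                          , subst₂ _<_ (sym pos′-k) (sym (pos′-transpose x)) lt

    inv-kept-outside : ∀ {k} → k ≢ i → k ≢ j → (pos v k < a → pos v k < b) → (pos v k < b → pos v k < a) →
                       inv raised k ≡ inv v k
    inv-kept-outside {k} k≢i k≢j a⇒b b⇒a = inv-cong {v = v′} {v} lower raise
      where
      c = pos v k
      pos′-k : pos v′ k ≡ c
      pos′-k = pos′-other k≢i k≢j
      lower : Inversion v′ k ⊆ Inversion v k
      lower (x<k , lt) = x<k , transpose-reflects (c <_) b⇒a a⇒b (subst (_< _) pos′-k lt)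
      raise : Inversion v k ⊆ Inversion v′ k
      raise (x<k , lt) = x<k , subst (_< _) (sym pos′-k) (transpose-preserves (c <_) b⇒a a⇒b lt)

  inv-kept : ∀ {k} → k ≢ i → inv raised k ≡ inv v k
  inv-kept {k} k≢i with k ≟ j
  ... | yes refl = inv-kept-at-j
  ... | no k≢j with Fin.<-cmp (pos v k) a
  ...   | tri< c<a _ _ = inv-kept-outside k≢i k≢j (λ _ → Fin.<-trans c<a a<b) (λ _ → c<a)
  ...   | tri≈ _ c≡a _ = contradiction (pos-injective v (trans c≡a (sym pos-j))) k≢j
  ...   | tri> _ _ a<c with Fin.<-cmp (pos v k) b
  ...     | tri< c<b _ _ = inv-kept-above (subst (i <_) (inverseʳ v) (gap (pos v k) a<c c<b))
  ...     | tri≈ _ c≡b _ = contradiction (pos-injective v c≡b) k≢i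
  ...     | tri> _ _ b<c = inv-kept-outside k≢i k≢j (λ c<a → contradiction c<a (Fin.<-asym a<c))
                                                   (λ c<b → contradiction c<b (Fin.<-asym b<c))

last-satisfying : ∀ {n p} {P : Pred (Fin n) p} → Decidable P → ∃ P → ∃ λ a → P a × (∀ q → P q → q ≤ a)
last-satisfying {suc n} P? (x , Px) with Fin.any? (P? ∘ suc)
... | yes later with last-satisfying (P? ∘ suc) later
...   | a , Pa , last = suc a , Pa , λ { zero _ → z≤n ; (suc q) Pq → s≤s (last q Pq) }
last-satisfying {suc n} P? (zero  , P0) | no none =
  zero , P0 , λ { zero _ → z≤n ; (suc q) Pq → contradiction (q , Pq) none }
last-satisfying {suc n} P? (suc x , Px) | no none = contradiction (x , Px) none

smaller-value-before : ∀ {n} (v : Perm n) (i : Fin n) → inv v i <ℕ toℕ i →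
                       ∃ λ q → v ⟨$⟩ʳ q < i × q < pos v i
smaller-value-before {n} v i small with Fin.any? (λ q → (v ⟨$⟩ʳ q <? i) ×-dec (q <? pos v i))
... | yes found = found
... | no none   = contradiction (begin
  toℕ i                   ≡⟨ count-< i ⟨
  count {n} (_<? i)       ≤⟨ count-mono (_<? i) (inversion? v i) (λ x<i → x<i , after-i x<i) ⟩
  count (inversion? v i)  ≡⟨ inv≡count v i ⟨
  inv v i                 ∎) (<⇒≱ small)
  where
  open ≤-Reasoning
  after-i : ∀ {x} → x < i → pos v i < pos v x
  after-i {x} x<i with Fin.<-cmp (pos v x) (pos v i)
  ... | tri< px<pi _ _ = contradiction (pos v x , subst (_< i) (sym (inverseʳ v)) x<i , px<pi) none
  ... | tri≈ _ px≡pi _ = contradiction (pos-injective v px≡pi) (Fin.<⇒≢ x<i)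
  ... | tri> _ _ pi<px = pi<px

raising-step : ∀ {n} (v : Perm n) (i : Fin n) → inv v i <ℕ toℕ i →
               Σ (Perm n) λ v′ → BruhatStep v v′ × inv v′ i ≡ suc (inv v i)
                               × (∀ k → k ≢ i → inv v′ k ≡ inv v k)
raising-step v i small
  with last-satisfying (λ q → (v ⟨$⟩ʳ q <? i) ×-dec (q <? pos v i)) (smaller-value-before v i small)
... | a , (va<i , a<b) , last = raised , step , inv-raised , λ _ → inv-kept
  where
  gap : ∀ q → a < q → q < pos v i → i < v ⟨$⟩ʳ q
  gap q a<q q<b = Fin.≤∧≢⇒< (≮⇒≥ λ vq<i → <⇒≱ a<q (last q (vq<i , q<b)))
                            (λ i≡vq → Fin.<⇒≢ q<b (trans (sym (inverseˡ v)) (cong (pos v) (sym i≡vq))))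
  open RaisingTransposition v i a a<b va<i gap

SameOrderBelow : ∀ {n} → Perm n → Perm n → ℕ → Set
SameOrderBelow {n} v w m =
  ∀ (x y : Fin n) → toℕ x <ℕ m → toℕ y <ℕ m → pos v x < pos v y → pos w x < pos w y

insertion-order : ∀ {n} (v w : Perm n) {i j : Fin n} → inv v i ≡ inv w i → SameOrderBelow v w (toℕ i) →
                  j < i → pos v j < pos v i → pos w j < pos w i
insertion-order {n} v w {i} {j} same agree j<i pvj<pvi with Fin.<-cmp (pos w j) (pos w i)
... | tri< pwj<pwi _ _ = pwj<pwi
... | tri≈ _ pwj≡pwi _ = contradiction (pos-injective w pwj≡pwi) (Fin.<⇒≢ j<i)
... | tri> _ _ pwi<pwj = contradiction same (<⇒≢ (begin-strict
  inv v i                                ≡⟨ inv≡count v i ⟩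
  count (inversion? v i)                 ≤⟨ count-mono (inversion? v i) (after-j v)
                                              (λ (x<i , lt) → x<i , Fin.<-trans pvj<pvi lt) ⟩
  count (after-j v)                      ≤⟨ count-mono (after-j v) (after-j w)
                                              (λ (x<i , lt) → x<i , agree j _ j<i x<i lt) ⟩
  count (after-j w)                      <⟨ n<1+n _ ⟩
  suc (count (after-j w))                ≡⟨ count-insert (after-j w) (λ (_ , lt) → Fin.<-irrefl refl lt) ⟨
  count (λ x → after-j w x ⊎-dec x ≟ j)  ≤⟨ count-mono (λ x → after-j w x ⊎-dec x ≟ j) (inversion? w i)
                                              (λ { (inj₁ (x<i , lt)) → x<i , Fin.<-trans pwi<pwj lt
                                                 ; (inj₂ refl)       → j<i , pwi<pwj }) ⟩
  count (inversion? w i)                 ≡⟨ inv≡count w i ⟨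
  inv w i                                ∎))
  where
  open ≤-Reasoning
  after-j : (u : Perm n) → Decidable (λ x → x < i × pos u j < pos u x)
  after-j u x = (x <? i) ×-dec (pos u j <? pos u x)

order-from-inv : ∀ {n} (v w : Perm n) → (∀ k → inv v k ≡ inv w k) → ∀ m → SameOrderBelow v w m
order-from-inv v w same zero _ _ ()
order-from-inv v w same (suc m) x y x≤m y≤m pvx<pvy with m<1+n⇒m<n∨m≡n x≤m | m<1+n⇒m<n∨m≡n y≤m
... | inj₁ x<m | inj₁ y<m = order-from-inv v w same m x y x<m y<m pvx<pvy
... | inj₁ x<m | inj₂ y≡m = insertion-order v w (same y) agree (subst (_ <ℕ_) (sym y≡m) x<m) pvx<pvy
  where agree = subst (SameOrderBelow v w) (sym y≡m) (order-from-inv v w same m)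
... | inj₂ x≡m | inj₂ y≡m =
  contradiction (Fin.toℕ-injective (trans x≡m (sym y≡m))) (Fin.<⇒≢ pvx<pvy ∘ cong (pos v))
... | inj₂ x≡m | inj₁ y<m with Fin.<-cmp (pos w x) (pos w y)
...   | tri< pwx<pwy _ _ = pwx<pwy
...   | tri≈ _ pwx≡pwy _ = contradiction (cong toℕ (pos-injective w pwx≡pwy)) (<⇒≢ y<x ∘ sym)
  where y<x = subst (_ <ℕ_) (sym x≡m) y<m
...   | tri> _ _ pwy<pwx =
  contradiction (insertion-order w v (sym (same x)) agree y<x pwy<pwx) (Fin.<-asym pvx<pvy)
  where y<x = subst (_ <ℕ_) (sym x≡m) y<m
        agree = subst (SameOrderBelow w v) (sym x≡m) (order-from-inv w v (λ k → sym (same k)) m)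

rank : ∀ {n} (w : Perm n) (x : Fin n) → count (λ y → pos w y <? pos w x) ≡ toℕ (pos w x)
rank {n} w x = begin
  count (λ y → pos w y <? pos w x)                ≡⟨ count-permute (λ y → pos w y <? pos w x) w ⟩
  count (λ p → pos w (w ⟨$⟩ʳ p) <? pos w x)       ≡⟨ count-cong (λ p → pos w (w ⟨$⟩ʳ p) <? pos w x)
                                                       (_<? pos w x) (subst (_< _) (inverseˡ w))
                                                       (subst (_< _) (sym (inverseˡ w))) ⟩
  count {n} (_<? pos w x)                         ≡⟨ count-< (pos w x) ⟩
  toℕ (pos w x)                                   ∎
  where open ≡-Reasoning

inv-injective : ∀ {n} (v w : Perm n) → (∀ k → inv v k ≡ inv w k) → ∀ p → v ⟨$⟩ʳ p ≡ w ⟨$⟩ʳ p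
inv-injective {n} v w same p = begin
  v ⟨$⟩ʳ p                   ≡⟨ inverseʳ w ⟨
  w ⟨$⟩ʳ pos w (v ⟨$⟩ʳ p)    ≡⟨ cong (w ⟨$⟩ʳ_) (same-pos (v ⟨$⟩ʳ p)) ⟨
  w ⟨$⟩ʳ pos v (v ⟨$⟩ʳ p)    ≡⟨ cong (w ⟨$⟩ʳ_) (inverseˡ v) ⟩
  w ⟨$⟩ʳ p                   ∎
  where
  open ≡-Reasoning
  same-pos : ∀ x → pos v x ≡ pos w x
  same-pos x = Fin.toℕ-injective (begin
    toℕ (pos v x)                     ≡⟨ rank v x ⟨
    count (λ y → pos v y <? pos v x)  ≡⟨ count-cong (λ y → pos v y <? pos v x) (λ y → pos w y <? pos w x)
                                           (λ {y} → order-from-inv v w same n y x (Fin.toℕ<n y) (Fin.toℕ<n x))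
                                           (λ {y} → order-from-inv w v (λ k → sym (same k)) n y x
                                                                   (Fin.toℕ<n y) (Fin.toℕ<n x)) ⟩
    count (λ y → pos w y <? pos w x)  ≡⟨ rank w x ⟩
    toℕ (pos w x)                     ∎)

distance : ∀ {n} → Perm n → Perm n → ℕ
distance w u = sum (λ k → inv w k ∸ inv u k)

step-toward : ∀ {n} (u w : Perm n) {i : Fin n} → u ≤M w → inv u i <ℕ inv w i →
              Σ (Perm n) λ u′ → BruhatStep u u′ × u′ ≤M w × distance w u ≡ suc (distance w u′)
step-toward u w {i} u≤w ui<wi with raising-step u i (<-≤-trans ui<wi (inv≤ w i))
... | u′ , step , raised , kept = u′ , step , u′≤w , drop
  where
  u′≤w : u′ ≤M w
  u′≤w k with k ≟ i
  ... | yes refl = subst (_≤ℕ inv w k) (sym raised) ui<wi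
  ... | no k≢i   = subst (_≤ℕ inv w k) (sym (kept k k≢i)) (u≤w k)
  drop : distance w u ≡ suc (distance w u′)
  drop = sum-suc-at i (trans (+-∸-assoc 1 ui<wi) (cong (λ m → suc (inv w i ∸ m)) (sym raised)))
                      (λ k k≢i → cong (inv w k ∸_) (sym (kept k k≢i)))

middle⇒bruhat : ∀ {n} {v w : Perm n} → v ≤M w → v ≤B w
middle⇒bruhat {v = v} {w} = climb (distance w v) v refl
  where
  climb : ∀ d u → distance w u ≡ d → u ≤M w → u ≤B w
  climb d u dist u≤w with Fin.any? (λ i → inv u i ℕ.<? inv w i)
  ... | no none = ≤B-refl (inv-injective u w (λ k → ≤-antisym (u≤w k) (≮⇒≥ (λ lt → none (k , lt)))))
  climb zero u dist u≤w | yes (_ , ui<wi) with step-toward u w u≤w ui<wi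
  ... | _ , _ , _ , drop = contradiction (trans (sym drop) dist) λ ()
  climb (suc d) u dist u≤w | yes (_ , ui<wi) with step-toward u w u≤w ui<wi
  ... | u′ , step , u′≤w , drop = ≤B-step step (climb d u′ (suc-injective (trans (sym drop) dist)) u′≤w)

TailBelow : ∀ {n} → Perm n → ℕ → Fin n → Set
TailBelow {n} w m i = ∀ p → n ∸ m ≤ℕ toℕ p → w ⟨$⟩ʳ p < i

tailBelow-step : ∀ {n} {v w : Perm n} {m i} → BruhatStep v w → TailBelow v m i → TailBelow w m i
tailBelow-step {v = v} {w} {m} {i} (a , b , a<b , va<vb , _ , w≗vτ) below p tail = by-cases (p ≟ a) (p ≟ b)
  where
  moved-from : ∀ {q} → PC.transpose a b p ≡ q → v ⟨$⟩ʳ q < i → w ⟨$⟩ʳ p < i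
  moved-from τp≡q = subst (_< i) (sym (trans (w≗vτ p) (cong (v ⟨$⟩ʳ_) τp≡q)))
  by-cases : Dec (p ≡ a) → Dec (p ≡ b) → w ⟨$⟩ʳ p < i
  by-cases (yes refl) _      = moved-from (transpose-matchˡ a b) (below b (≤-trans tail (<⇒≤ a<b)))
  by-cases (no _) (yes refl) = moved-from (transpose-matchʳ a b) (Fin.<-trans va<vb (below b tail))
  by-cases (no p≢a) (no p≢b) = moved-from (transpose-fixes a b p≢a p≢b) (below p tail)

tailBelow-≤B : ∀ {n} {v w : Perm n} {m i} → v ≤B w → TailBelow v m i → TailBelow w m i
tailBelow-≤B {i = i} (≤B-refl v≗w) below p tail = subst (_< i) (v≗w p) (below p tail)
tailBelow-≤B {v = v} {m = m} {i} (≤B-step {v = u} step rest) below =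
  tailBelow-≤B {m = m} {i} rest (tailBelow-step {v = v} {u} {m} {i} step below)

tailBelow⇒≤inv : ∀ {n} {w : Perm n} {m i} → TailBelow w m i → m ≤ℕ inv w i
tailBelow⇒≤inv {n} {w} {m} {i} below = begin
  m                                                  ≡⟨ m∸[m∸n]≡n m≤n ⟨
  n ∸ (n ∸ m)                                        ≡⟨ count-≥ n (n ∸ m) ⟨
  count {n} (λ p → n ∸ m ℕ.≤? toℕ p)                 ≤⟨ count-mono (λ p → n ∸ m ℕ.≤? toℕ p) (inversionAt? w i)
                                                          (λ {p} tail → below p tail , <-≤-trans pi<tail tail) ⟩
  count (inversionAt? w i)                           ≡⟨ inv≡count-positions w i ⟨
  inv w i                                            ∎
  where
  open ≤-Reasoning
  pi<tail : toℕ (pos w i) <ℕ n ∸ m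
  pi<tail = ≰⇒> (λ tail → Fin.<-irrefl (inverseʳ w) (below (pos w i) tail))
  m≤n : m ≤ℕ n
  m≤n = <⇒≤ (m∸n≢0⇒n<m (λ n∸m≡0 → n≮0 (subst (toℕ (pos w i) <ℕ_) n∸m≡0 pi<tail)))

avoids213⇒tailBelow : ∀ {n} {v : Perm n} → Avoids213 v → ∀ i → TailBelow v (inv v i) i
avoids213⇒tailBelow {n} {v} avoids i p tail with v ⟨$⟩ʳ p <? i
... | yes vp<i = vp<i
... | no  vp≮i = contradiction tail (<⇒≱ (begin-strict
  toℕ p                    <⟨ n<1+n _ ⟩
  suc (toℕ p)              ≡⟨ m∸[m∸n]≡n (Fin.toℕ<n p) ⟨
  n ∸ (n ∸ suc (toℕ p))    ≤⟨ ∸-monoʳ-≤ n inv≤n∸[1+p] ⟩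
  n ∸ inv v i              ∎))
  where
  open ≤-Reasoning
  after-p : InversionAt v i ⊆ (p <_)
  after-p {q} (vq<i , pi<q) with Fin.<-cmp q p
  ... | tri< q<p _ _ = contradiction (subst (_ <_) (sym (inverseʳ v)) vq<i , subst (_< _) (sym (inverseʳ v)) i<vp)
                         (avoids (pos v i) q p pi<q q<p)
    where
    p≢pos-i : p ≢ pos v i
    p≢pos-i p≡pi = Fin.<-asym pi<q (subst (q <_) p≡pi q<p)
    i<vp : i < v ⟨$⟩ʳ p
    i<vp = Fin.≤∧≢⇒< (≮⇒≥ vp≮i) (λ i≡vp → p≢pos-i (trans (sym (inverseˡ v)) (cong (pos v) (sym i≡vp))))
  ... | tri≈ _ q≡p _ = contradiction (subst (λ r → v ⟨$⟩ʳ r < i) q≡p vq<i) vp≮i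
  ... | tri> _ _ p<q = p<q
  inv≤n∸[1+p] : inv v i ≤ℕ n ∸ suc (toℕ p)
  inv≤n∸[1+p] = begin
    inv v i                                   ≡⟨ inv≡count-positions v i ⟩
    count (inversionAt? v i)                  ≤⟨ count-mono (inversionAt? v i) (λ q → suc (toℕ p) ℕ.≤? toℕ q)
                                                            after-p ⟩
    count {n} (λ q → suc (toℕ p) ℕ.≤? toℕ q)  ≡⟨ count-≥ n (suc (toℕ p)) ⟩
    n ∸ suc (toℕ p)                           ∎

bruhat⇒middle : ∀ {n} {v w : Perm n} → Avoids213 v → v ≤B w → v ≤M w
bruhat⇒middle {v = v} {w} avoids v≤w i =
  tailBelow⇒≤inv {w = w} (tailBelow-≤B {m = inv v i} v≤w (avoids213⇒tailBelow {v = v} avoids i))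

corollary1p10 : (n : ℕ) (v w : Perm n) → Avoids213 v → Avoids213 w →
    (v ≤M w → v ≤B w) × (v ≤B w → v ≤M w)
corollary1p10 n v w v-avoids _ = middle⇒bruhat , bruhat⇒middle v-avoids
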